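{- Let $\Gamma$ be a type environment and $r,s$ terms. Suppose that $\Gamma\vdash r=s$ is valid in every nominal model $\mathcal I$ of the simply-typed $\lambda$-calculus, i.e. for every such $\mathcal I$ there is a type $\phi$ with $\Gamma\vdash r:\phi$, $\Gamma\vdash s:\phi$, and $[\![r]\!]^{\mathcal I}_\Gamma=[\![s]\!]^{\mathcal I}_\Gamma\in\mathcal I_\Gamma(\phi)$. Then $r=_\beta s$.
   Context: Atoms and nominal sets: fix a countably infinite set $\mathbb A$ of atoms; permutations are bijections of $\mathbb A$ moving finitely many atoms, acting on ZFA sets by $\pi\cdot a=\pi(a)$, $\pi\cdot X=\{\pi\cdot x\mid x\in X\}$; $\mathrm{supp}(x)$ is the least finite set $A$ such that every permutation fixing $A$ pointwise fixes $x$; $a\#x$ means $a\notin\mathrm{supp}(x)$. Syntax: simple types $\phi::=\tau\mid\phi\to\phi$ over a nonempty set of base types; constants $C$ with types $\mathrm{type}(C)$; terms $r::=a\mid C\mid\lambda a{:}\phi.r\mid rr$ up to $\alpha$-equivalence; $r[a:=t]$ capture-avoiding substitution. $=_\beta$ is the least equivalence relation on terms closed under: $r=_\beta r'$, $s=_\beta s'$ imply $rs=_\beta r's'$; $s=_\beta s'$ implies $\lambda a{:}\phi.s=_\beta\lambda a{:}\phi.s'$; and $(\lambda a{:}\phi.r)t=_\beta r[a:=t]$. Type environments $\Gamma$: functional sets of typings $a{:}\phi$; $\mathrm{dom}(\Gamma)$ their atoms. Typing rules: $\Gamma,a{:}\phi\vdash a:\phi$; $\Gamma\vdash C:\mathrm{type}(C)$;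 $\Gamma,a{:}\phi\vdash r:\psi$ ($a\notin\mathrm{dom}(\Gamma)$) gives $\Gamma\vdash\lambda a{:}\phi.r:\phi\to\psi$; $\Gamma\vdash r:\phi\to\psi$, $\Gamma\vdash s:\phi$ give $\Gamma\vdash rs:\psi$. Model: $\mathcal I$ assigns to each $\Gamma,\phi$ a finitely-supported set $\mathcal I_\Gamma(\phi)$, with $a^{\mathcal I}_\phi\in\mathcal I_\Gamma(\phi)$ for $a{:}\phi\in\Gamma$, $C^{\mathcal I}\in\mathcal I_\Gamma(\mathrm{type}(C))$, abstraction $[a{:}\phi]x\in\mathcal I_\Gamma(\phi\to\psi)$ for $x\in\mathcal I_{\Gamma,a:\phi}(\psi)$, application $x\bullet y\in\mathcal I_\Gamma(\psi)$ for $x\in\mathcal I_\Gamma(\phi\to\psi),y\in\mathcal I_\Gamma(\phi)$; satisfying $\mathcal I_{\Gamma\cap\Gamma'}(\phi)=\mathcal I_\Gamma(\phi)\cap\mathcal I_{\Gamma'}(\phi)$; $\mathrm{supp}(x)\subseteq\mathrm{dom}(\Gamma)$ for $x\in\mathcal I_\Gamma(\phi)$; equivariance ($\pi\cdot\mathcal I_\Gamma(\phi)=\mathcal I_{\pi\cdot\Gamma}(\phi)$, $\pi\cdot a^{\mathcal I}_\phi=\pi(a)^{\mathcal I}_\phi$, $\pi\cdot C^{\mathcal I}=C^{\mathcal I}$, $\pi\cdot[a{:}\phi]x=[\pi(a){:}\phi]\pi\cdot x$, $\pi\cdot(x\bullet y)=\pi\cdot x\bullet\pi\cdot y$); and with $x[a\mapsto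 y]:=([a{:}\phi]x)\bullet y$: $a^{\mathcal I}_\phi[a\mapsto x]=x$; $a\#z\Rightarrow z[a\mapsto x]=z$; $(z'\bullet z)[a\mapsto x]=(z'[a\mapsto x])\bullet(z[a\mapsto x])$; $c\#x\Rightarrow([c{:}\chi]z)[a\mapsto x]=[c{:}\chi](z[a\mapsto x])$. Interpretation of $\Gamma\vdash r:\phi$ in $\mathcal I$: $[\![a]\!]^{\mathcal I}_\Gamma=a^{\mathcal I}_\phi$, $[\![C]\!]^{\mathcal I}_\Gamma=C^{\mathcal I}$, $[\![rs]\!]^{\mathcal I}_\Gamma=[\![r]\!]^{\mathcal I}_\Gamma\bullet[\![s]\!]^{\mathcal I}_\Gamma$, $[\![\lambda a{:}\phi.r]\!]^{\mathcal I}_\Gamma=[a{:}\phi][\![r]\!]^{\mathcal I}_{\Gamma,a:\phi}$. -}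

module Defs where

open import Data.Nat using (ℕ; zero; suc; _≟_)
open import Data.Fin using (Fin; inject₁; fromℕ)
open import Data.Bool using (if_then_else_)
open import Data.List using (List; []; _∷_; map)
open import Data.List.Membership.Propositional using (_∈_; _∉_)
open import Data.Product using (Σ; _×_; _,_; proj₁)
open import Relation.Nullary using (does)
open import Relation.Binary.PropositionalEquality using (_≡_)
open import Relation.Binary.Structures using (IsEquivalence)
open import Function.Bundles using (_⇔_)

Atom : Set
Atom = ℕ

record Perm : Set where
  field
    to      : Atom → Atom
    from    : Atom → Atom
    to-from : ∀ a → to (from a) ≡ a
    from-to : ∀ a → from (to a) ≡ a
    moved   : List Atom
    fixes   : ∀ a → a ∉ moved → to a ≡ a

open Perm public using (to; from)

infixr 30 _⇒_
data Ty (B : Set) : Set where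
  base : B → Ty B
  _⇒_  : Ty B → Ty B → Ty B

-- Support / freshness for an arbitrary carrier with a permutation
-- action and an equality (a setoid).  `Supports A x`: every permutation
-- fixing A pointwise fixes x (so supp(x) ⊆ A).  `a # x`: a lies outside
-- some finite support of x, i.e. a ∉ supp(x).

Supports : {C : Set} → (C → C → Set) → (Perm → C → C) → List Atom → C → Set
Supports _≈_ act A x = ∀ π → (∀ b → b ∈ A → to π b ≡ b) → act π x ≈ x

Fresh : {C : Set} → (C → C → Set) → (Perm → C → C) → Atom → C → Set
Fresh _≈_ act a x = Σ (List Atom) λ A → (a ∉ A) × Supports _≈_ act A x

module Lambda (B : Set) (K : Set) (type : K → Ty B) where

  Type : Set
  Type = Ty B

  -- Terms up to α-equivalence, in locally nameless form: free variables
  -- are atoms, bound variables are de Bruijn indices; Tm n = terms with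
  -- at most n dangling bound indices.
  data Tm (n : ℕ) : Set where
    bvar : Fin n → Tm n
    fvar : Atom → Tm n
    con  : K → Tm n
    lam  : Type → Tm (suc n) → Tm n
    app  : Tm n → Tm n → Tm n

  Term : Set
  Term = Tm 0

  wk : ∀ {n} → Tm n → Tm (suc n)
  wk (bvar i)  = bvar (inject₁ i)
  wk (fvar b)  = fvar b
  wk (con c)   = con c
  wk (lam φ t) = lam φ (wk t)
  wk (app t u) = app (wk t) (wk u)

  embed : ∀ n → Term → Tm n
  embed zero    t = t
  embed (suc n) t = wk (embed n t)

  close : ∀ {n} → Atom → Tm n → Tm (suc n)
  close     a (bvar i)  = bvar (inject₁ i)
  close {n} a (fvar b)  = if does (a ≟ b) then bvar (fromℕ n) else fvar b
  close     a (con c)   = con c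
  close     a (lam φ t) = lam φ (close a t)
  close     a (app t u) = app (close a t) (close a u)

  ƛ : Atom → Type → Term → Term
  ƛ a φ r = lam φ (close a r)

  subst : ∀ {n} → Atom → Term → Tm n → Tm n
  subst     a t (bvar i)  = bvar i
  subst {n} a t (fvar b)  = if does (a ≟ b) then embed n t else fvar b
  subst     a t (con c)   = con c
  subst     a t (lam φ u) = lam φ (subst a t u)
  subst     a t (app u v) = app (subst a t u) (subst a t v)

  infix 4 _=β_
  data _=β_ : Term → Term → Set where
    β-refl  : ∀ {r} → r =β r
    β-sym   : ∀ {r s} → r =β s → s =β r
    β-trans : ∀ {r s t} → r =β s → s =β t → r =β t
    β-app   : ∀ {r r' s s'} → r =β r' → s =β s' → app r s =β app r' s'
    β-lam   : ∀ {a φ s s'} → s =β s' → ƛ a φ s =β ƛ a φ s'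
    β-β     : ∀ {a φ r t} → app (ƛ a φ r) t =β subst a t r

  -- Type environments: finite lists of typings, required to be
  -- functional where they are used.
  Env : Set
  Env = List (Atom × Type)

  dom : Env → List Atom
  dom = map proj₁

  Functional : Env → Set
  Functional Γ = ∀ a φ ψ → (a , φ) ∈ Γ → (a , ψ) ∈ Γ → φ ≡ ψ

  IsIntersection : Env → Env → Env → Set
  IsIntersection Δ Γ Γ' = ∀ a φ → ((a , φ) ∈ Δ) ⇔ (((a , φ) ∈ Γ) × ((a , φ) ∈ Γ'))

  permEnv : Perm → Env → Env
  permEnv π = map (λ p → (to π (proj₁ p) , Data.Product.proj₂ p))

  infix 4 _⊢_∶_
  data _⊢_∶_ (Γ : Env) : Term → Type → Set where
    ⊢var : ∀ {a φ} → (a , φ) ∈ Γ → Γ ⊢ fvar a ∶ φ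
    ⊢con : ∀ {C} → Γ ⊢ con C ∶ type C
    ⊢lam : ∀ {a φ ψ r} → a ∉ dom Γ → ((a , φ) ∷ Γ) ⊢ r ∶ ψ → Γ ⊢ ƛ a φ r ∶ φ ⇒ ψ
    ⊢app : ∀ {r s φ ψ} → Γ ⊢ r ∶ φ ⇒ ψ → Γ ⊢ s ∶ φ → Γ ⊢ app r s ∶ ψ

  -- Nominal models.  The ZFA universe is replaced by a carrier setoid
  -- with a permutation action; each 𝓘_Γ(φ) is a (≈-closed) predicate on it.
  record Model : Set₁ where
    infixl 9 _•_
    field
      Carrier  : Set
      _≈_      : Carrier → Carrier → Set
      ≈-equiv  : IsEquivalence _≈_
      act      : Perm → Carrier → Carrier
      act-cong : ∀ π {x y} → x ≈ y → act π x ≈ act π y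
      act-id   : ∀ π x → (∀ a → to π a ≡ a) → act π x ≈ x
      act-comp : ∀ π σ τ x → (∀ a → to τ a ≡ to π (to σ a)) →
                 act π (act σ x) ≈ act τ x

      I        : Env → Type → Carrier → Set
      I-resp   : ∀ Γ φ {x y} → x ≈ y → I Γ φ x → I Γ φ y

      var      : Atom → Type → Carrier
      cst      : K → Carrier
      abs      : Atom → Type → Carrier → Carrier
      _•_      : Carrier → Carrier → Carrier
      abs-cong : ∀ a φ {x y} → x ≈ y → abs a φ x ≈ abs a φ y
      •-cong   : ∀ {x x' y y'} → x ≈ x' → y ≈ y' → (x • y) ≈ (x' • y')

      var∈     : ∀ Γ → Functional Γ → ∀ a φ → (a , φ) ∈ Γ → I Γ φ (var a φ)
      cst∈     : ∀ Γ → Functional Γ → ∀ C → I Γ (type C) (cst C)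
      abs∈     : ∀ Γ → Functional Γ → ∀ a φ ψ x → a ∉ dom Γ →
                 I ((a , φ) ∷ Γ) ψ x → I Γ (φ ⇒ ψ) (abs a φ x)
      •∈       : ∀ Γ → Functional Γ → ∀ φ ψ x y →
                 I Γ (φ ⇒ ψ) x → I Γ φ y → I Γ ψ (x • y)

      I-inter  : ∀ Γ Γ' Δ → Functional Γ → Functional Γ' → Functional Δ →
                 IsIntersection Δ Γ Γ' →
                 ∀ φ x → I Δ φ x ⇔ (I Γ φ x × I Γ' φ x)
      I-supp   : ∀ Γ → Functional Γ → ∀ φ x → I Γ φ x → Supports _≈_ act (dom Γ) x

      I-equiv₁ : ∀ π Γ → Functional Γ → ∀ φ x →
                 I Γ φ x → I (permEnv π Γ) φ (act π x)
      I-equiv₂ : ∀ π Γ → Functional Γ → ∀ φ y →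
                 I (permEnv π Γ) φ y → Σ Carrier λ x → I Γ φ x × (y ≈ act π x)
      var-equiv : ∀ π a φ → act π (var a φ) ≈ var (to π a) φ
      cst-equiv : ∀ π C → act π (cst C) ≈ cst C
      abs-equiv : ∀ π a φ x → act π (abs a φ x) ≈ abs (to π a) φ (act π x)
      •-equiv   : ∀ π x y → act π (x • y) ≈ (act π x • act π y)

      -- substitution axioms, x[a ↦ y] := ([a:φ]x) • y, for
      -- Γ functional, a ∉ dom Γ, x ∈ 𝓘_Γ(φ) and z, z' ∈ 𝓘_{Γ,a:φ}(-)
      sub-var  : ∀ Γ → Functional Γ → ∀ a φ x → a ∉ dom Γ → I Γ φ x →
                 (abs a φ (var a φ) • x) ≈ x
      sub-#    : ∀ Γ → Functional Γ → ∀ a φ x → a ∉ dom Γ → I Γ φ x →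
                 ∀ ψ z → I ((a , φ) ∷ Γ) ψ z → Fresh _≈_ act a z →
                 (abs a φ z • x) ≈ z
      sub-•    : ∀ Γ → Functional Γ → ∀ a φ x → a ∉ dom Γ → I Γ φ x →
                 ∀ χ ψ z' z → I ((a , φ) ∷ Γ) (χ ⇒ ψ) z' → I ((a , φ) ∷ Γ) χ z →
                 (abs a φ (z' • z) • x) ≈ ((abs a φ z' • x) • (abs a φ z • x))
      sub-abs  : ∀ Γ → Functional Γ → ∀ a φ x → a ∉ dom Γ → I Γ φ x →
                 ∀ c χ ψ z → c ∉ dom ((a , φ) ∷ Γ) → Fresh _≈_ act c x →
                 I ((c , χ) ∷ (a , φ) ∷ Γ) ψ z →
                 (abs a φ (abs c χ z) • x) ≈ abs c χ (abs a φ z • x)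

  ⟦_⟧ : (M : Model) → ∀ {Γ r φ} → Γ ⊢ r ∶ φ → Model.Carrier M
  ⟦ M ⟧ (⊢var {a} {φ} _)   = Model.var M a φ
  ⟦ M ⟧ (⊢con {C})         = Model.cst M C
  ⟦ M ⟧ (⊢lam {a} {φ} _ d) = Model.abs M a φ (⟦ M ⟧ d)
  ⟦ M ⟧ (⊢app d e)         = Model._•_ M (⟦ M ⟧ d) (⟦ M ⟧ e)

  ValidIn : Model → Env → Term → Term → Set
  ValidIn M Γ r s =
    Σ Type λ φ → Σ (Γ ⊢ r ∶ φ) λ dr → Σ (Γ ⊢ s ∶ φ) λ ds →
      Model._≈_ M (⟦ M ⟧ dr) (⟦ M ⟧ ds)

module Submission where

-- The proof builds one particular model, the term model, and reads the
-- equation off in it.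

open import Defs
open import Data.Product using (∃; _×_; _,_; proj₁; proj₂)
open import Data.Nat using (ℕ; zero; suc; _≟_; _≡ᵇ_)
open import Data.Nat.Properties using (≡ᵇ⇒≡; ≡⇒≡ᵇ; 1+n≰n)
open import Data.Fin using (Fin; zero; suc; inject₁; fromℕ)
open import Data.Unit using (⊤; tt)
open import Data.Empty using (⊥-elim)
open import Data.Bool using (true; false; if_then_else_; T)
open import Data.List using (List; []; _∷_; _++_; tabulate)
open import Data.List.Extrema.Nat using (max; xs≤max)
open import Data.List.Relation.Unary.All as All using ()
open import Data.List.Relation.Unary.Any using (here; there)
open import Data.List.Membership.Propositional using (_∈_; _∉_)
open import Data.List.Membership.Propositional.Properties
  using (∈-map⁺; ∈-map⁻; ∈-++⁺ˡ; ∈-++⁺ʳ; ∈-tabulate⁺)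
open import Function.Bundles using (_⇔_; mk⇔; Equivalence)
open import Relation.Nullary using (does; yes; no)
open import Relation.Binary.Bundles using (Setoid)
open import Relation.Binary.Structures using (IsEquivalence)
open import Relation.Binary.Construct.Closure.Equivalence as EqClosure
  using (EqClosure; gmap; gfold)
open import Relation.Binary.Construct.Closure.Symmetric using (fwd; bwd)
open import Relation.Binary.Construct.Closure.ReflexiveTransitive
  using (Star; ε; _◅_; _◅◅_)
open import Relation.Binary.PropositionalEquality as Eq
  using (_≡_; _≢_; refl; sym; trans; cong; cong₂)
import Relation.Binary.Reasoning.Setoid as SetoidReasoning

if-≟ : ∀ {A : Set} (R : A → Set) a b {x y : A} →
       (a ≡ b → R x) → (a ≢ b → R y) → R (if does (a ≟ b) then x else y)
if-≟ R a b same differ with a ≡ᵇ b in eq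
... | true  = same (≡ᵇ⇒≡ a b (Eq.subst T (sym eq) tt))
... | false = differ (λ a≡b → Eq.subst T eq (≡⇒≡ᵇ a b a≡b))

if-≟-same : ∀ {A : Set} a {x y : A} → (if does (a ≟ a) then x else y) ≡ x
if-≟-same a = if-≟ (λ z → z ≡ _) a a (λ _ → refl) (λ a≢a → ⊥-elim (a≢a refl))

if-≟-diff : ∀ {A : Set} {a b} {x y : A} → a ≢ b → (if does (a ≟ b) then x else y) ≡ y
if-≟-diff {a = a} {b} a≢b =
  if-≟ (λ z → z ≡ _) a b (λ a≡b → ⊥-elim (a≢b a≡b)) (λ _ → refl)

if-≟-other : ∀ {A : Set} {a b} {x y : A} → b ≢ a → (if does (a ≟ b) then x else y) ≡ y
if-≟-other b≢a = if-≟-diff (λ a≡b → b≢a (sym a≡b))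

fresh : List Atom → Atom
fresh A = suc (max 0 A)

fresh-∉ : ∀ A → fresh A ∉ A
fresh-∉ A m = 1+n≰n (All.lookup (xs≤max 0 A) m)

fresh-≢ : ∀ {b} A → b ∈ A → b ≢ fresh A
fresh-≢ A m refl = fresh-∉ A m

fresh-avoids : ∀ {n} A (cs : Fin n → Atom) i → cs i ≢ fresh (A ++ tabulate cs)
fresh-avoids A cs i = fresh-≢ (A ++ tabulate cs) (∈-++⁺ʳ A (∈-tabulate⁺ i))

swap : Atom → Atom → Atom → Atom
swap a d b = if does (a ≟ b) then d else (if does (d ≟ b) then a else b)

swap-left : ∀ a d → swap a d a ≡ d
swap-left a d = if-≟-same a

swap-right : ∀ a d → swap a d d ≡ a
swap-right a d = if-≟ (λ z → z ≡ a) a d sym (λ _ → if-≟-same d)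

swap-other : ∀ a d b → a ≢ b → d ≢ b → swap a d b ≡ b
swap-other a d b a≢b d≢b = trans (if-≟-diff a≢b) (if-≟-diff d≢b)

swap-involutive : ∀ a d b → swap a d (swap a d b) ≡ b
swap-involutive a d b with a ≟ b | d ≟ b
... | yes refl | _        = trans (cong (swap a d) (swap-left a d)) (swap-right a d)
... | no _     | yes refl = trans (cong (swap a d) (swap-right a d)) (swap-left a d)
... | no a≢b   | no d≢b   =
  trans (cong (swap a d) (swap-other a d b a≢b d≢b)) (swap-other a d b a≢b d≢b)

swap-≢ : ∀ a d b → b ≢ d → swap a d b ≢ a
swap-≢ a d b b≢d with a ≟ b
... | yes refl = λ da → b≢d (sym (trans (sym (swap-left a d)) da))
... | no a≢b   = λ ba →
  a≢b (sym (trans (sym (swap-other a d b a≢b (λ d≡b → b≢d (sym d≡b)))) ba))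

swapPerm : Atom → Atom → Perm
swapPerm a d = record
  { to      = swap a d
  ; from    = swap a d
  ; to-from = swap-involutive a d
  ; from-to = swap-involutive a d
  ; moved   = a ∷ d ∷ []
  ; fixes   = λ b b∉ → swap-other a d b (λ a≡b → b∉ (here (sym a≡b)))
                                        (λ d≡b → b∉ (there (here (sym d≡b))))
  }

module RawTerms (B K : Set) where

  -- Raw terms in locally nameless form with typed free atoms: Raw n has at
  -- most n dangling de Bruijn indices, and `fv a τ` records the type at
  -- which the atom a occurs, so that free typings can be read off a term.
  data Raw : ℕ → Set where
    bv : ∀ {n} → Fin n → Raw n
    fv : ∀ {n} → Atom → Ty B → Raw n
    cn : ∀ {n} → K → Raw n
    lm : ∀ {n} → Ty B → Raw (suc n) → Raw n
    ap : ∀ {n} → Raw n → Raw n → Raw n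

  private variable n m k : ℕ

  Ren : ℕ → ℕ → Set
  Ren n m = Fin n → Fin m

  Sub : ℕ → ℕ → Set
  Sub n m = Fin n → Raw m

  FreeSub : ℕ → Set
  FreeSub m = Atom → Ty B → Raw m

  -- The empty renaming and substitution, named so that all their uses
  -- are definitionally the same function.
  noRen : Ren 0 m
  noRen ()

  noSub : Sub 0 m
  noSub ()

  liftRen : Ren n m → Ren (suc n) (suc m)
  liftRen ρ zero    = zero
  liftRen ρ (suc i) = suc (ρ i)

  ren : Ren n m → Raw n → Raw m
  ren ρ (bv i)   = bv (ρ i)
  ren ρ (fv a τ) = fv a τ
  ren ρ (cn c)   = cn c
  ren ρ (lm φ t) = lm φ (ren (liftRen ρ) t)
  ren ρ (ap t u) = ap (ren ρ t) (ren ρ u)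

  liftSub : Sub n m → Sub (suc n) (suc m)
  liftSub σ zero    = bv zero
  liftSub σ (suc i) = ren suc (σ i)

  liftFree : FreeSub m → FreeSub (suc m)
  liftFree f a τ = ren suc (f a τ)

  sub : Sub n m → FreeSub m → Raw n → Raw m
  sub σ f (bv i)   = σ i
  sub σ f (fv a τ) = f a τ
  sub σ f (cn c)   = cn c
  sub σ f (lm φ t) = lm φ (sub (liftSub σ) (liftFree f) t)
  sub σ f (ap t u) = ap (sub σ f t) (sub σ f u)

  data AllFree (P : Atom → Ty B → Set) : ∀ {n} → Raw n → Set where
    abv : ∀ {n} {i : Fin n} → AllFree P (bv i)
    afv : ∀ {n a τ} → P a τ → AllFree P {n} (fv a τ)
    acn : ∀ {n c} → AllFree P {n} (cn c)
    alm : ∀ {n φ} {t : Raw (suc n)} → AllFree P t → AllFree P (lm φ t)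
    aap : ∀ {n} {t u : Raw n} → AllFree P t → AllFree P u → AllFree P (ap t u)

  -- The trivial predicate holds everywhere; it turns the AllFree-relative
  -- lemmas below into unconditional ones.
  everywhere : (t : Raw n) → AllFree (λ _ _ → ⊤) t
  everywhere (bv i)   = abv
  everywhere (fv a τ) = afv tt
  everywhere (cn c)   = acn
  everywhere (lm φ t) = alm (everywhere t)
  everywhere (ap t u) = aap (everywhere t) (everywhere u)

  AllFree-map : ∀ {P Q : Atom → Ty B → Set} → (∀ a τ → P a τ → Q a τ) →
                {t : Raw n} → AllFree P t → AllFree Q t
  AllFree-map h abv       = abv
  AllFree-map h (afv p)   = afv (h _ _ p)
  AllFree-map h acn       = acn
  AllFree-map h (alm p)   = alm (AllFree-map h p)
  AllFree-map h (aap p q) = aap (AllFree-map h p) (AllFree-map h q)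

  AllFree-zip : ∀ {P Q : Atom → Ty B → Set} {t : Raw n} → AllFree P t → AllFree Q t →
                AllFree (λ a τ → P a τ × Q a τ) t
  AllFree-zip abv       abv         = abv
  AllFree-zip (afv p)   (afv q)     = afv (p , q)
  AllFree-zip acn       acn         = acn
  AllFree-zip (alm p)   (alm q)     = alm (AllFree-zip p q)
  AllFree-zip (aap p p') (aap q q') = aap (AllFree-zip p q) (AllFree-zip p' q')

  liftRen-cong : {ρ ρ' : Ren n m} → (∀ i → ρ i ≡ ρ' i) → ∀ i → liftRen ρ i ≡ liftRen ρ' i
  liftRen-cong h zero    = refl
  liftRen-cong h (suc i) = cong suc (h i)

  ren-cong : {ρ ρ' : Ren n m} → (∀ i → ρ i ≡ ρ' i) → ∀ t → ren ρ t ≡ ren ρ' t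
  ren-cong h (bv i)   = cong bv (h i)
  ren-cong h (fv a τ) = refl
  ren-cong h (cn c)   = refl
  ren-cong h (lm φ t) = cong (lm φ) (ren-cong (liftRen-cong h) t)
  ren-cong h (ap t u) = cong₂ ap (ren-cong h t) (ren-cong h u)

  ren-ren : (ρ : Ren m k) (ρ' : Ren n m) (t : Raw n) → ren ρ (ren ρ' t) ≡ ren (λ i → ρ (ρ' i)) t
  ren-ren ρ ρ' (bv i)   = refl
  ren-ren ρ ρ' (fv a τ) = refl
  ren-ren ρ ρ' (cn c)   = refl
  ren-ren ρ ρ' (lm φ t) =
    cong (lm φ) (trans (ren-ren (liftRen ρ) (liftRen ρ') t) (ren-cong lift-comp t))
    where lift-comp : ∀ i → liftRen ρ (liftRen ρ' i) ≡ liftRen (λ j → ρ (ρ' j)) i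
          lift-comp zero    = refl
          lift-comp (suc i) = refl
  ren-ren ρ ρ' (ap t u) = cong₂ ap (ren-ren ρ ρ' t) (ren-ren ρ ρ' u)

  ren-id : {ρ : Ren n n} → (∀ i → ρ i ≡ i) → ∀ t → ren ρ t ≡ t
  ren-id h (bv i)   = cong bv (h i)
  ren-id h (fv a τ) = refl
  ren-id h (cn c)   = refl
  ren-id h (lm φ t) = cong (lm φ) (ren-id lift-id t)
    where lift-id : ∀ i → liftRen _ i ≡ i
          lift-id zero    = refl
          lift-id (suc i) = cong suc (h i)
  ren-id h (ap t u) = cong₂ ap (ren-id h t) (ren-id h u)

  liftSub-cong : {σ σ' : Sub n m} → (∀ i → σ i ≡ σ' i) → ∀ i → liftSub σ i ≡ liftSub σ' i
  liftSub-cong h zero    = refl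
  liftSub-cong h (suc i) = cong (ren suc) (h i)

  sub-cong : ∀ {P} {σ σ' : Sub n m} {f f' : FreeSub m} →
             (∀ i → σ i ≡ σ' i) → (∀ a τ → P a τ → f a τ ≡ f' a τ) →
             ∀ {t} → AllFree P t → sub σ f t ≡ sub σ' f' t
  sub-cong hσ hf (abv {i = i})       = hσ i
  sub-cong hσ hf (afv {a = a} {τ} p) = hf a τ p
  sub-cong hσ hf acn                 = refl
  sub-cong hσ hf (alm p)             =
    cong (lm _) (sub-cong (liftSub-cong hσ) (λ a τ q → cong (ren suc) (hf a τ q)) p)
  sub-cong hσ hf (aap p q)           = cong₂ ap (sub-cong hσ hf p) (sub-cong hσ hf q)

  sub-ext : {σ σ' : Sub n m} {f f' : FreeSub m} →
            (∀ i → σ i ≡ σ' i) → (∀ a τ → f a τ ≡ f' a τ) → ∀ t → sub σ f t ≡ sub σ' f' t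
  sub-ext hσ hf t = sub-cong hσ (λ a τ _ → hf a τ) (everywhere t)

  sub-is-ren : ∀ {P} {σ : Sub n m} {f : FreeSub m} {ρ : Ren n m} →
               (∀ i → σ i ≡ bv (ρ i)) → (∀ a τ → P a τ → f a τ ≡ fv a τ) →
               ∀ {t} → AllFree P t → sub σ f t ≡ ren ρ t
  sub-is-ren hσ hf (abv {i = i})       = hσ i
  sub-is-ren hσ hf (afv {a = a} {τ} p) = hf a τ p
  sub-is-ren hσ hf acn                 = refl
  sub-is-ren hσ hf (alm p)             =
    cong (lm _) (sub-is-ren (lift hσ) (λ a τ q → cong (ren suc) (hf a τ q)) p)
    where lift : ∀ {σ : Sub n m} {ρ} → (∀ i → σ i ≡ bv (ρ i)) →
                 ∀ i → liftSub σ i ≡ bv (liftRen ρ i)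
          lift h zero    = refl
          lift h (suc i) = cong (ren suc) (h i)
  sub-is-ren hσ hf (aap p q)           = cong₂ ap (sub-is-ren hσ hf p) (sub-is-ren hσ hf q)

  ren-as-sub : (ρ : Ren n m) (t : Raw n) → ren ρ t ≡ sub (λ i → bv (ρ i)) fv t
  ren-as-sub ρ t = sym (sub-is-ren (λ _ → refl) (λ _ _ _ → refl) (everywhere t))

  sub-id-on : ∀ {P} {σ : Sub n n} {f : FreeSub n} →
              (∀ i → σ i ≡ bv i) → (∀ a τ → P a τ → f a τ ≡ fv a τ) →
              ∀ {t} → AllFree P t → sub σ f t ≡ t
  sub-id-on hσ hf {t} p = trans (sub-is-ren {ρ = λ i → i} hσ hf p) (ren-id (λ _ → refl) t)

  sub-id : {σ : Sub n n} {f : FreeSub n} →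
           (∀ i → σ i ≡ bv i) → (∀ a τ → f a τ ≡ fv a τ) → ∀ t → sub σ f t ≡ t
  sub-id hσ hf t = sub-id-on hσ (λ a τ _ → hf a τ) (everywhere t)

  sub-ren : (σ : Sub m k) (f : FreeSub k) (ρ : Ren n m) (t : Raw n) →
            sub σ f (ren ρ t) ≡ sub (λ i → σ (ρ i)) f t
  sub-ren σ f ρ (bv i)   = refl
  sub-ren σ f ρ (fv a τ) = refl
  sub-ren σ f ρ (cn c)   = refl
  sub-ren σ f ρ (lm φ t) =
    cong (lm φ) (trans (sub-ren (liftSub σ) (liftFree f) (liftRen ρ) t)
                       (sub-ext lift-comp (λ _ _ → refl) t))
    where lift-comp : ∀ i → liftSub σ (liftRen ρ i) ≡ liftSub (λ j → σ (ρ j)) i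
          lift-comp zero    = refl
          lift-comp (suc i) = refl
  sub-ren σ f ρ (ap t u) = cong₂ ap (sub-ren σ f ρ t) (sub-ren σ f ρ u)

  ren-sub : (ρ : Ren m k) (σ : Sub n m) (f : FreeSub m) (t : Raw n) →
            ren ρ (sub σ f t) ≡ sub (λ i → ren ρ (σ i)) (λ a τ → ren ρ (f a τ)) t
  ren-sub ρ σ f (bv i)   = refl
  ren-sub ρ σ f (fv a τ) = refl
  ren-sub ρ σ f (cn c)   = refl
  ren-sub ρ σ f (lm φ t) =
    cong (lm φ) (trans (ren-sub (liftRen ρ) (liftSub σ) (liftFree f) t)
                       (sub-ext lift-comp (λ a τ → ren-suc-comm (f a τ)) t))
    where ren-suc-comm : ∀ u → ren (liftRen ρ) (ren suc u) ≡ ren suc (ren ρ u)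
          ren-suc-comm u = trans (ren-ren (liftRen ρ) suc u) (sym (ren-ren suc ρ u))
          lift-comp : ∀ i → ren (liftRen ρ) (liftSub σ i) ≡ liftSub (λ j → ren ρ (σ j)) i
          lift-comp zero    = refl
          lift-comp (suc i) = ren-suc-comm (σ i)
  ren-sub ρ σ f (ap t u) = cong₂ ap (ren-sub ρ σ f t) (ren-sub ρ σ f u)

  sub-sub : (σ : Sub m k) (f : FreeSub k) (σ' : Sub n m) (f' : FreeSub m) (t : Raw n) →
            sub σ f (sub σ' f' t) ≡ sub (λ i → sub σ f (σ' i)) (λ a τ → sub σ f (f' a τ)) t
  sub-sub σ f σ' f' (bv i)   = refl
  sub-sub σ f σ' f' (fv a τ) = refl
  sub-sub σ f σ' f' (cn c)   = refl
  sub-sub σ f σ' f' (lm φ t) =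
    cong (lm φ) (trans (sub-sub (liftSub σ) (liftFree f) (liftSub σ') (liftFree f') t)
                       (sub-ext lift-comp (λ a τ → sub-suc-comm (f' a τ)) t))
    where sub-suc-comm : ∀ u → sub (liftSub σ) (liftFree f) (ren suc u) ≡ ren suc (sub σ f u)
          sub-suc-comm u = trans (sub-ren (liftSub σ) (liftFree f) suc u) (sym (ren-sub suc σ f u))
          lift-comp : ∀ i → sub (liftSub σ) (liftFree f) (liftSub σ' i)
                            ≡ liftSub (λ j → sub σ f (σ' j)) i
          lift-comp zero    = refl
          lift-comp (suc i) = sub-suc-comm (σ' i)
  sub-sub σ f σ' f' (ap t u) = cong₂ ap (sub-sub σ f σ' f' t) (sub-sub σ f σ' f' u)

  single : Raw n → Sub (suc n) n
  single M zero    = M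
  single M (suc i) = bv i

  infixl 8 _[_]
  _[_] : Raw (suc n) → Raw n → Raw n
  N [ M ] = sub (single M) fv N

  sub-weakened : (M u : Raw m) → sub (single M) fv (ren suc u) ≡ u
  sub-weakened M u = trans (sub-ren (single M) fv suc u) (sub-id (λ _ → refl) (λ _ _ → refl) u)

  sub-[] : (σ : Sub n m) (f : FreeSub m) (N : Raw (suc n)) (M : Raw n) →
           sub σ f (N [ M ]) ≡ sub (liftSub σ) (liftFree f) N [ sub σ f M ]
  sub-[] σ f N M =
    trans (sub-sub σ f (single M) fv N)
          (sym (trans (sub-sub (single (sub σ f M)) fv (liftSub σ) (liftFree f) N)
                      (sub-ext single-comp (λ a τ → sub-weakened (sub σ f M) (f a τ)) N)))
    where single-comp : ∀ i → sub (single (sub σ f M)) fv (liftSub σ i) ≡ sub σ f (single M i)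
          single-comp zero    = refl
          single-comp (suc i) = sub-weakened (sub σ f M) (σ i)

  ren-[] : (ρ : Ren n m) (N : Raw (suc n)) (M : Raw n) → ren ρ (N [ M ]) ≡ ren (liftRen ρ) N [ ren ρ M ]
  ren-[] ρ N M = begin
      ren ρ (N [ M ])
    ≡⟨ ren-as-sub ρ (N [ M ]) ⟩
      sub (λ i → bv (ρ i)) fv (N [ M ])
    ≡⟨ sub-[] (λ i → bv (ρ i)) fv N M ⟩
      sub (liftSub (λ i → bv (ρ i))) (liftFree fv) N [ sub (λ i → bv (ρ i)) fv M ]
    ≡⟨ cong₂ _[_] (sub-is-ren lift (λ _ _ _ → refl) (everywhere N)) (sym (ren-as-sub ρ M)) ⟩
      ren (liftRen ρ) N [ ren ρ M ] ∎
    where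
      open Eq.≡-Reasoning
      lift : ∀ i → liftSub (λ i → bv (ρ i)) i ≡ bv (liftRen ρ i)
      lift zero    = refl
      lift (suc i) = refl

  infix 4 _⟶_ _≈β_ _⇛_ _⇛*_
  data _⟶_ : ∀ {n} → Raw n → Raw n → Set where
    β    : ∀ {n φ} {N : Raw (suc n)} {M} → ap (lm φ N) M ⟶ N [ M ]
    ξ    : ∀ {n φ} {N N' : Raw (suc n)} → N ⟶ N' → lm φ N ⟶ lm φ N'
    appˡ : ∀ {n} {L L' M : Raw n} → L ⟶ L' → ap L M ⟶ ap L' M
    appʳ : ∀ {n} {L M M' : Raw n} → M ⟶ M' → ap L M ⟶ ap L M'

  _≈β_ : Raw n → Raw n → Set
  _≈β_ = EqClosure _⟶_

  ≈β-isEquivalence : IsEquivalence (_≈β_ {n})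
  ≈β-isEquivalence = EqClosure.isEquivalence _⟶_

  ≈β-setoid : ℕ → Setoid _ _
  ≈β-setoid n = EqClosure.setoid (_⟶_ {n})

  module ≈β {n} = IsEquivalence (≈β-isEquivalence {n})

  step : {x y : Raw n} → x ⟶ y → x ≈β y
  step s = fwd s ◅ ε

  ≈β-lm : ∀ {φ} {x y : Raw (suc n)} → x ≈β y → lm φ x ≈β lm φ y
  ≈β-lm = gmap (lm _) ξ

  ≈β-ap : {x x' y y' : Raw n} → x ≈β x' → y ≈β y' → ap x y ≈β ap x' y'
  ≈β-ap p q = gmap (λ z → ap z _) appˡ p ◅◅ gmap (ap _) appʳ q

  sub-step : (σ : Sub n m) (f : FreeSub m) {x y : Raw n} → x ⟶ y → sub σ f x ⟶ sub σ f y
  sub-step σ f (β {N = N} {M}) = Eq.subst (sub σ f (ap (lm _ N) M) ⟶_) (sym (sub-[] σ f N M)) β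
  sub-step σ f (ξ s)    = ξ (sub-step (liftSub σ) (liftFree f) s)
  sub-step σ f (appˡ s) = appˡ (sub-step σ f s)
  sub-step σ f (appʳ s) = appʳ (sub-step σ f s)

  sub-≈β : (σ : Sub n m) (f : FreeSub m) {x y : Raw n} → x ≈β y → sub σ f x ≈β sub σ f y
  sub-≈β σ f = gmap (sub σ f) (sub-step σ f)

  ren-≈β : (ρ : Ren n m) {x y : Raw n} → x ≈β y → ren ρ x ≈β ren ρ y
  ren-≈β ρ {x} {y} p =
    Eq.subst₂ _≈β_ (sym (ren-as-sub ρ x)) (sym (ren-as-sub ρ y)) (sub-≈β _ fv p)

  sub-≈β-free : (σ : Sub n m) {f f' : FreeSub m} →
                (∀ a τ → f a τ ≈β f' a τ) → ∀ t → sub σ f t ≈β sub σ f' t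
  sub-≈β-free σ h (bv i)   = ≈β.refl
  sub-≈β-free σ h (fv a τ) = h a τ
  sub-≈β-free σ h (cn c)   = ≈β.refl
  sub-≈β-free σ h (lm φ t) = ≈β-lm (sub-≈β-free (liftSub σ) (λ a τ → ren-≈β suc (h a τ)) t)
  sub-≈β-free σ h (ap t u) = ≈β-ap (sub-≈β-free σ h t) (sub-≈β-free σ h u)

  data _⇛_ : ∀ {n} → Raw n → Raw n → Set where
    pbv : ∀ {n} {i : Fin n} → bv i ⇛ bv i
    pfv : ∀ {n a τ} → fv {n} a τ ⇛ fv a τ
    pcn : ∀ {n c} → cn {n} c ⇛ cn c
    plm : ∀ {n φ} {N N' : Raw (suc n)} → N ⇛ N' → lm φ N ⇛ lm φ N'
    pap : ∀ {n} {L L' M M' : Raw n} → L ⇛ L' → M ⇛ M' → ap L M ⇛ ap L' M'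
    pβ  : ∀ {n φ} {N N' : Raw (suc n)} {M M'} → N ⇛ N' → M ⇛ M' → ap (lm φ N) M ⇛ N' [ M' ]

  _⇛*_ : Raw n → Raw n → Set
  _⇛*_ = Star _⇛_

  par-refl : (t : Raw n) → t ⇛ t
  par-refl (bv i)   = pbv
  par-refl (fv a τ) = pfv
  par-refl (cn c)   = pcn
  par-refl (lm φ t) = plm (par-refl t)
  par-refl (ap t u) = pap (par-refl t) (par-refl u)

  ren-par : (ρ : Ren n m) {x y : Raw n} → x ⇛ y → ren ρ x ⇛ ren ρ y
  ren-par ρ pbv       = pbv
  ren-par ρ pfv       = pfv
  ren-par ρ pcn       = pcn
  ren-par ρ (plm p)   = plm (ren-par (liftRen ρ) p)
  ren-par ρ (pap p q) = pap (ren-par ρ p) (ren-par ρ q)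
  ren-par ρ (pβ {N' = N'} {M' = M'} p q) =
    Eq.subst (_ ⇛_) (sym (ren-[] ρ N' M')) (pβ (ren-par (liftRen ρ) p) (ren-par ρ q))

  lift-par : {σ σ' : Sub n m} → (∀ i → σ i ⇛ σ' i) → ∀ i → liftSub σ i ⇛ liftSub σ' i
  lift-par h zero    = pbv
  lift-par h (suc i) = ren-par suc (h i)

  lift-par-free : {f f' : FreeSub m} → (∀ a τ → f a τ ⇛ f' a τ) →
                  ∀ a τ → liftFree f a τ ⇛ liftFree f' a τ
  lift-par-free h a τ = ren-par suc (h a τ)

  sub-par : {σ σ' : Sub n m} {f f' : FreeSub m} →
            (∀ i → σ i ⇛ σ' i) → (∀ a τ → f a τ ⇛ f' a τ) →
            ∀ {x y} → x ⇛ y → sub σ f x ⇛ sub σ' f' y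
  sub-par hσ hf (pbv {i = i})       = hσ i
  sub-par hσ hf (pfv {a = a} {τ})   = hf a τ
  sub-par hσ hf pcn                 = pcn
  sub-par hσ hf (plm p)             = plm (sub-par (lift-par hσ) (lift-par-free hf) p)
  sub-par hσ hf (pap p q)           = pap (sub-par hσ hf p) (sub-par hσ hf q)
  sub-par {σ' = σ'} {f' = f'} hσ hf (pβ {N' = N'} {M' = M'} p q) =
    Eq.subst (_ ⇛_) (sym (sub-[] σ' f' N' M'))
      (pβ (sub-par (lift-par hσ) (lift-par-free hf) p) (sub-par hσ hf q))

  inst-par : {N N' : Raw (suc n)} {M M' : Raw n} → N ⇛ N' → M ⇛ M' → N [ M ] ⇛ N' [ M' ]
  inst-par {M = M} {M'} p q = sub-par single-par (λ _ _ → pfv) p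
    where single-par : ∀ i → single M i ⇛ single M' i
          single-par zero    = q
          single-par (suc i) = pbv

  develop : Raw n → Raw n
  develop (bv i)          = bv i
  develop (fv a τ)        = fv a τ
  develop (cn c)          = cn c
  develop (lm φ N)        = lm φ (develop N)
  develop (ap (lm φ N) M) = develop N [ develop M ]
  develop (ap L M)        = ap (develop L) (develop M)

  triangle : {x y : Raw n} → x ⇛ y → y ⇛ develop x
  triangle pbv                          = pbv
  triangle pfv                          = pfv
  triangle pcn                          = pcn
  triangle (plm p)                      = plm (triangle p)
  triangle (pap {L = bv i} p q)         = pap (triangle p) (triangle q)
  triangle (pap {L = fv a τ} p q)       = pap (triangle p) (triangle q)
  triangle (pap {L = cn c} p q)         = pap (triangle p) (triangle q)
  triangle (pap {L = ap L L'} p q)      = pap (triangle p) (triangle q)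
  triangle (pap {L = lm φ N} (plm p) q) = pβ (triangle p) (triangle q)
  triangle (pβ p q)                     = inst-par (triangle p) (triangle q)

  strip : {x y z : Raw n} → x ⇛ y → x ⇛* z → ∃ λ w → (y ⇛* w) × (z ⇛ w)
  strip {y = y} p ε = y , ε , p
  strip p (s ◅ q) with strip (triangle s) q
  ... | w , y'⇛*w , z⇛w = w , triangle p ◅ y'⇛*w , z⇛w

  step-par : {x y : Raw n} → x ⟶ y → x ⇛ y
  step-par (β {N = N} {M})  = pβ (par-refl N) (par-refl M)
  step-par (ξ s)            = plm (step-par s)
  step-par (appˡ {M = M} s) = pap (step-par s) (par-refl M)
  step-par (appʳ {L = L} s) = pap (par-refl L) (step-par s)

  par-≈β : {x y : Raw n} → x ⇛ y → x ≈β y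
  par-≈β pbv       = ≈β.refl
  par-≈β pfv       = ≈β.refl
  par-≈β pcn       = ≈β.refl
  par-≈β (plm p)   = ≈β-lm (par-≈β p)
  par-≈β (pap p q) = ≈β-ap (par-≈β p) (par-≈β q)
  par-≈β (pβ p q)  = ≈β-ap (≈β-lm (par-≈β p)) (par-≈β q) ◅◅ step β

  pars-≈β : {x y : Raw n} → x ⇛* y → x ≈β y
  pars-≈β ε       = ≈β.refl
  pars-≈β (s ◅ p) = par-≈β s ◅◅ pars-≈β p

  -- Church–Rosser: convertible terms have a common reduct.  Induction on the
  -- path: a backward step is absorbed by the strip lemma.
  church-rosser : {x y : Raw n} → x ≈β y → ∃ λ w → (x ⇛* w) × (y ⇛* w)
  church-rosser {x = x} ε = x , ε , ε
  church-rosser (fwd s ◅ p) with church-rosser p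
  ... | w , x'⇛*w , y⇛*w = w , step-par s ◅ x'⇛*w , y⇛*w
  church-rosser (bwd s ◅ p) with church-rosser p
  ... | w , x'⇛*w , y⇛*w with strip (step-par s) x'⇛*w
  ... | v , x⇛*v , w⇛v = v , x⇛*v , y⇛*w ◅◅ (w⇛v ◅ ε)

  AllFree-ren : ∀ {P} (ρ : Ren n m) {t} → AllFree P t → AllFree P (ren ρ t)
  AllFree-ren ρ abv       = abv
  AllFree-ren ρ (afv p)   = afv p
  AllFree-ren ρ acn       = acn
  AllFree-ren ρ (alm p)   = alm (AllFree-ren (liftRen ρ) p)
  AllFree-ren ρ (aap p q) = aap (AllFree-ren ρ p) (AllFree-ren ρ q)

  AllFree-sub : ∀ {P Q} {σ : Sub n m} {f : FreeSub m} →
                (∀ i → AllFree Q (σ i)) → (∀ a τ → P a τ → AllFree Q (f a τ)) →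
                ∀ {t} → AllFree P t → AllFree Q (sub σ f t)
  AllFree-sub hσ hf (abv {i = i})       = hσ i
  AllFree-sub hσ hf (afv {a = a} {τ} p) = hf a τ p
  AllFree-sub hσ hf acn                 = acn
  AllFree-sub hσ hf (alm p)             =
    alm (AllFree-sub (lift hσ) (λ a τ q → AllFree-ren suc (hf a τ q)) p)
    where lift : ∀ {Q} {σ : Sub n m} → (∀ i → AllFree Q (σ i)) → ∀ i → AllFree Q (liftSub σ i)
          lift h zero    = abv
          lift h (suc i) = AllFree-ren suc (h i)
  AllFree-sub hσ hf (aap p q)           = aap (AllFree-sub hσ hf p) (AllFree-sub hσ hf q)

  AllFree-par : ∀ {P} {x y : Raw n} → x ⇛ y → AllFree P x → AllFree P y
  AllFree-par pbv       p = p
  AllFree-par pfv       p = p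
  AllFree-par pcn       p = p
  AllFree-par (plm r)   (alm p)   = alm (AllFree-par r p)
  AllFree-par (pap r s) (aap p q) = aap (AllFree-par r p) (AllFree-par s q)
  AllFree-par {P = P} (pβ {M' = M'} r s) (aap (alm p) q) =
    AllFree-sub single-ok (λ _ _ → afv) (AllFree-par r p)
    where single-ok : ∀ i → AllFree P (single M' i)
          single-ok zero    = AllFree-par s q
          single-ok (suc i) = abv

  AllFree-pars : ∀ {P} {x y : Raw n} → x ⇛* y → AllFree P x → AllFree P y
  AllFree-pars ε       p = p
  AllFree-pars (r ◅ s) p = AllFree-pars s (AllFree-par r p)

  bindAt : Atom → FreeSub 1
  bindAt a b τ = if does (a ≟ b) then bv zero else fv b τ

  bind : Atom → Raw 0 → Raw 1
  bind a = sub noSub (bindAt a)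

  absR : Atom → Ty B → Raw 0 → Raw 0
  absR a φ x = lm φ (bind a x)

  substAt : Atom → Raw 0 → FreeSub 0
  substAt a x b τ = if does (a ≟ b) then x else fv b τ

  substR : Atom → Raw 0 → Raw 0 → Raw 0
  substR a x = sub bv (substAt a x)

  renameAt : (Atom → Atom) → FreeSub 0
  renameAt p b τ = fv (p b) τ

  permR : Perm → Raw 0 → Raw 0
  permR π = sub bv (renameAt (to π))

  β-named : ∀ a φ z x → ap (absR a φ z) x ≈β substR a x z
  β-named a φ z x =
    step β ◅◅ ≈β.reflexive (trans (sub-sub (single x) fv noSub (bindAt a) z)
                                  (sub-ext (λ ()) instantiate-bindAt z))
    where instantiate-bindAt : ∀ b τ → sub (single x) fv (bindAt a b τ) ≡ substAt a x b τ
          instantiate-bindAt b τ =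
            if-≟ (λ w → sub (single x) fv w ≡ substAt a x b τ) a b
                 (λ { refl → sym (if-≟-same a) }) (λ a≢b → sym (if-≟-diff a≢b))

  permR-id : ∀ π x → (∀ a → to π a ≡ a) → permR π x ≡ x
  permR-id π x fixed = sub-id (λ _ → refl) (λ a τ → cong (λ b → fv b τ) (fixed a)) x

  permR-comp : ∀ π σ τ x → (∀ a → to τ a ≡ to π (to σ a)) → permR π (permR σ x) ≡ permR τ x
  permR-comp π σ τ x comp =
    trans (sub-sub bv (renameAt (to π)) bv (renameAt (to σ)) x)
          (sub-ext (λ ()) (λ a χ → cong (λ b → fv b χ) (sym (comp a))) x)

  -- Abstraction is equivariant (π is injective, so bindAt commutes with it).
  permR-absR : ∀ π a φ x → permR π (absR a φ x) ≡ absR (to π a) φ (permR π x)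
  permR-absR π a φ x = cong (lm φ) (trans
    (sub-sub (liftSub bv) (liftFree (renameAt (to π))) noSub (bindAt a) x)
    (sym (trans (sub-sub noSub (bindAt (to π a)) bv (renameAt (to π)) x)
                (sub-ext (λ ()) bind-renamed x))))
    where
      to-injective : ∀ b → to π a ≡ to π b → a ≡ b
      to-injective b e = trans (sym (Perm.from-to π a)) (trans (cong (from π) e) (Perm.from-to π b))
      bind-renamed : ∀ b τ → bindAt (to π a) (to π b) τ
                             ≡ sub (liftSub bv) (liftFree (renameAt (to π))) (bindAt a b τ)
      bind-renamed b τ =
        if-≟ (λ w → bindAt (to π a) (to π b) τ
                    ≡ sub (liftSub bv) (liftFree (renameAt (to π))) w) a b
             (λ { refl → if-≟-same (to π a) })
             (λ a≢b → if-≟-diff (λ e → a≢b (to-injective b e)))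

  substAt-≈β : ∀ a {x x'} → x ≈β x' → ∀ b τ → substAt a x b τ ≈β substAt a x' b τ
  substAt-≈β a {x} {x'} x≈x' b τ =
    if-≟ (λ w → w ≈β substAt a x' b τ) a b
         (λ { refl → Eq.subst (x ≈β_) (sym (if-≟-same a)) x≈x' })
         (λ a≢b → ≈β.reflexive (sym (if-≟-diff a≢b)))

  _#_ : Atom → Raw n → Set
  c # t = AllFree (λ b _ → b ≢ c) t

  atoms : Raw n → List Atom
  atoms (bv i)   = []
  atoms (fv a τ) = a ∷ []
  atoms (cn c)   = []
  atoms (lm φ t) = atoms t
  atoms (ap t u) = atoms t ++ atoms u

  atoms-complete : (t : Raw n) → AllFree (λ b _ → b ∈ atoms t) t
  atoms-complete (bv i)   = abv
  atoms-complete (fv a τ) = afv (here refl)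
  atoms-complete (cn c)   = acn
  atoms-complete (lm φ t) = alm (atoms-complete t)
  atoms-complete (ap t u) = aap (AllFree-map (λ _ _ → ∈-++⁺ˡ) (atoms-complete t))
                                (AllFree-map (λ _ _ → ∈-++⁺ʳ (atoms t)) (atoms-complete u))

  fresh-# : (t : Raw n) (A : List Atom) → (∀ {b} → b ∈ atoms t → b ∈ A) → fresh A # t
  fresh-# t A atoms⊆A = AllFree-map (λ b _ b∈ → fresh-≢ A (atoms⊆A b∈)) (atoms-complete t)

  substR-# : ∀ a x z → a # z → substR a x z ≡ z
  substR-# a x z a#z = sub-id-on (λ _ → refl) (λ _ _ → if-≟-other) a#z

  substR-bind : ∀ a c x z → a ≢ c → c # x →
                sub (liftSub bv) (liftFree (substAt a x)) (bind c z) ≡ bind c (substR a x z)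
  substR-bind a c x z a≢c c#x =
    trans (sub-sub (liftSub bv) (liftFree (substAt a x)) noSub (bindAt c) z)
          (sym (trans (sub-sub noSub (bindAt c) bv (substAt a x) z) (sub-ext (λ ()) pointwise z)))
    where
      bind-weakens-x : sub noSub (bindAt c) x ≡ ren suc x
      bind-weakens-x = sub-is-ren (λ ()) (λ _ _ → if-≟-other) c#x
      pointwise : ∀ b τ → sub noSub (bindAt c) (substAt a x b τ)
                          ≡ sub (liftSub bv) (liftFree (substAt a x)) (bindAt c b τ)
      pointwise b τ =
        if-≟ (λ w → sub noSub (bindAt c) (substAt a x b τ)
                    ≡ sub (liftSub bv) (liftFree (substAt a x)) w) c b
          (λ { refl → trans (cong (sub noSub (bindAt c)) (if-≟-diff a≢c)) (if-≟-same c) })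
          (λ c≢b → if-≟ (λ w → sub noSub (bindAt c) w ≡ ren suc w) a b
                        (λ _ → bind-weakens-x) (λ _ → if-≟-diff c≢b))

  permR-swap-# : ∀ c d x → d # x → c # permR (swapPerm c d) x
  permR-swap-# c d x d#x = AllFree-sub (λ ()) (λ b τ b≢d → afv (swap-≢ c d b b≢d)) d#x

  -- Nominal support gives syntactic freshness up to conversion: if x is
  -- supported by A and c ∉ A, then (c d)·x ≈β x avoids c for d fresh.
  fresh-representative : ∀ c A x → c ∉ A → Supports _≈β_ permR A x →
                         ∃ λ x' → x ≈β x' × c # x'
  fresh-representative c A x c∉A supported =
    permR π x , ≈β.sym (supported π fixes-A) , permR-swap-# c d x d#x
    where
      d = fresh (A ++ atoms x)
      π = swapPerm c d
      d#x : d # x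
      d#x = fresh-# x (A ++ atoms x) (∈-++⁺ʳ A)
      fixes-A : ∀ b → b ∈ A → swap c d b ≡ b
      fixes-A b b∈A = swap-other c d b (λ c≡b → c∉A (Eq.subst (_∈ A) (sym c≡b) b∈A))
                                       (λ d≡b → fresh-≢ (A ++ atoms x) (∈-++⁺ˡ b∈A) (sym d≡b))

module Completeness (B : Set) (b₀ : B) (K : Set) (type : K → Ty B) where
  open Lambda B K type
  open RawTerms B K

  private variable n : ℕ

  erase : Raw n → Tm n
  erase (bv i)   = bvar i
  erase (fv a τ) = fvar a
  erase (cn c)   = con c
  erase (lm φ t) = lam φ (erase t)
  erase (ap t u) = app (erase t) (erase u)

  erase-ren-inject₁ : {ρ : Ren n (suc n)} → (∀ i → ρ i ≡ inject₁ i) →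
                      ∀ t → erase (ren ρ t) ≡ wk (erase t)
  erase-ren-inject₁ h (bv i)   = cong bvar (h i)
  erase-ren-inject₁ h (fv a τ) = refl
  erase-ren-inject₁ h (cn c)   = refl
  erase-ren-inject₁ h (lm φ t) = cong (lam φ) (erase-ren-inject₁ lift t)
    where lift : ∀ i → liftRen _ i ≡ inject₁ i
          lift zero    = refl
          lift (suc i) = cong suc (h i)
  erase-ren-inject₁ h (ap t u) = cong₂ app (erase-ren-inject₁ h t) (erase-ren-inject₁ h u)

  erase-embed : ∀ k (m : Raw 0) → erase (ren noRen m) ≡ embed k (erase m)
  erase-embed zero    m = cong erase (ren-id (λ ()) m)
  erase-embed (suc k) m = begin
      erase (ren noRen m)
    ≡⟨ cong erase (trans (ren-cong (λ ()) m) (sym (ren-ren inject₁ noRen m))) ⟩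
      erase (ren inject₁ (ren noRen m))
    ≡⟨ erase-ren-inject₁ (λ _ → refl) (ren noRen m) ⟩
      wk (erase (ren noRen m))
    ≡⟨ cong wk (erase-embed k m) ⟩
      wk (embed k (erase m)) ∎
    where open Eq.≡-Reasoning

  erase-closing : ∀ {k} a {σ : Sub k (suc k)} {f : FreeSub (suc k)} →
                  (∀ i → σ i ≡ bv (inject₁ i)) → (∀ τ → f a τ ≡ bv (fromℕ k)) →
                  (∀ b τ → a ≢ b → f b τ ≡ fv b τ) →
                  ∀ t → erase (sub σ f t) ≡ close a (erase t)
  erase-closing a hσ ha hb (bv i)   = cong erase (hσ i)
  erase-closing a {f = f} hσ ha hb (fv b τ) =
    if-≟ (λ w → erase (f b τ) ≡ w) a b (λ { refl → cong erase (ha τ) })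
                                       (λ a≢b → cong erase (hb b τ a≢b))
  erase-closing a hσ ha hb (cn c)   = refl
  erase-closing a hσ ha hb (lm φ t) =
    cong (lam φ) (erase-closing a lift (λ τ → cong (ren suc) (ha τ))
                                       (λ b τ a≢b → cong (ren suc) (hb b τ a≢b)) t)
    where lift : ∀ i → liftSub _ i ≡ bv (inject₁ i)
          lift zero    = refl
          lift (suc i) = cong (ren suc) (hσ i)
  erase-closing a hσ ha hb (ap t u) =
    cong₂ app (erase-closing a hσ ha hb t) (erase-closing a hσ ha hb u)

  erase-bind : ∀ a x → erase (bind a x) ≡ close a (erase x)
  erase-bind a = erase-closing a (λ ()) (λ τ → if-≟-same a) (λ b τ a≢b → if-≟-diff a≢b)

  erase-substituting : ∀ {k} c (m : Raw 0) {σ : Sub k k} {f : FreeSub k} →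
                       (∀ i → σ i ≡ bv i) → (∀ τ → f c τ ≡ ren noRen m) →
                       (∀ b τ → c ≢ b → f b τ ≡ fv b τ) →
                       ∀ t → erase (sub σ f t) ≡ subst c (erase m) (erase t)
  erase-substituting c m hσ hc hb (bv i)   = cong erase (hσ i)
  erase-substituting {k} c m {f = f} hσ hc hb (fv b τ) =
    if-≟ (λ w → erase (f b τ) ≡ w) c b (λ { refl → trans (cong erase (hc τ)) (erase-embed k m) })
         (λ c≢b → cong erase (hb b τ c≢b))
  erase-substituting c m hσ hc hb (cn k)   = refl
  erase-substituting c m {f = f} hσ hc hb (lm φ t) =
    cong (lam φ) (erase-substituting c m lift weakened-m (λ b τ c≢b → cong (ren suc) (hb b τ c≢b)) t)
    where lift : ∀ i → liftSub _ i ≡ bv i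
          lift zero    = refl
          lift (suc i) = cong (ren suc) (hσ i)
          weakened-m : ∀ τ → ren suc (f c τ) ≡ ren noRen m
          weakened-m τ = trans (cong (ren suc) (hc τ)) (trans (ren-ren suc noRen m) (ren-cong (λ ()) m))
  erase-substituting c m hσ hc hb (ap t u) =
    cong₂ app (erase-substituting c m hσ hc hb t) (erase-substituting c m hσ hc hb u)

  erase-substR : ∀ c m z → erase (substR c m z) ≡ subst c (erase m) (erase z)
  erase-substR c m =
    erase-substituting c m (λ _ → refl) (λ τ → trans (if-≟-same c) (sym (ren-id (λ ()) m)))
                           (λ b τ c≢b → if-≟-diff c≢b)

  -- To erase a β-step under binders, dangling indices are instantiated by
  -- atoms (of the arbitrary type τ₀) and binders are opened at fresh atoms.
  τ₀ : Ty B
  τ₀ = base b₀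

  inst : (Fin n → Atom) → Raw n → Raw 0
  inst cs = sub (λ i → fv (cs i) τ₀) fv

  _∷ᶜ_ : Atom → (Fin n → Atom) → Fin (suc n) → Atom
  (c ∷ᶜ cs) zero    = c
  (c ∷ᶜ cs) (suc i) = cs i

  noAtoms : Fin 0 → Atom
  noAtoms ()

  inst-closed : (x : Raw 0) → inst noAtoms x ≡ x
  inst-closed = sub-id (λ ()) (λ _ _ → refl)

  erase-inst-lm : ∀ (cs : Fin n → Atom) c φ N → c # N → (∀ i → cs i ≢ c) →
                  erase (inst cs (lm φ N)) ≡ ƛ c φ (erase (inst (c ∷ᶜ cs) N))
  erase-inst-lm cs c φ N c#N cs≢c =
    cong (lam φ) (trans (cong erase opened) (erase-bind c (inst (c ∷ᶜ cs) N)))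
    where
      pointwise : ∀ i → sub noSub (bindAt c) (fv ((c ∷ᶜ cs) i) τ₀) ≡ liftSub (λ i → fv (cs i) τ₀) i
      pointwise zero    = if-≟-same c
      pointwise (suc i) = if-≟-other (cs≢c i)
      opened : sub (liftSub (λ i → fv (cs i) τ₀)) (liftFree fv) N ≡ bind c (inst (c ∷ᶜ cs) N)
      opened = sym (trans (sub-sub noSub (bindAt c) (λ i → fv ((c ∷ᶜ cs) i) τ₀) fv N)
                          (sub-cong pointwise (λ _ _ → if-≟-other) c#N))

  inst-[] : ∀ (cs : Fin n → Atom) c N M → c # N → (∀ i → cs i ≢ c) →
            substR c (inst cs M) (inst (c ∷ᶜ cs) N) ≡ inst cs (N [ M ])
  inst-[] cs c N M c#N cs≢c =
    trans (sub-sub bv (substAt c (inst cs M)) (λ i → fv ((c ∷ᶜ cs) i) τ₀) fv N)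
          (sym (trans (sub-sub (λ i → fv (cs i) τ₀) fv (single M) fv N)
                      (sym (sub-cong pointwise (λ _ _ → if-≟-other) c#N))))
    where pointwise : ∀ i → substR c (inst cs M) (fv ((c ∷ᶜ cs) i) τ₀) ≡ inst cs (single M i)
          pointwise zero    = if-≟-same c
          pointwise (suc i) = if-≟-other (cs≢c i)

  =β-isEquivalence : IsEquivalence _=β_
  =β-isEquivalence = record { refl = β-refl ; sym = β-sym ; trans = β-trans }

  =β-setoid : Setoid _ _
  =β-setoid = record { isEquivalence = =β-isEquivalence }

  -- Erasure maps a reduction step, under any instantiation, into =β; the
  -- binder opened in the β and ξ cases uses an atom fresh for everything.
  erase-step : {x y : Raw n} → x ⟶ y → (cs : Fin n → Atom) → erase (inst cs x) =β erase (inst cs y)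
  erase-step (β {φ = φ} {N} {M}) cs = begin
      app (erase (inst cs (lm φ N))) (erase (inst cs M))
    ≡⟨ cong (λ t → app t (erase (inst cs M))) (erase-inst-lm cs c φ N c#N cs≢c) ⟩
      app (ƛ c φ (erase (inst (c ∷ᶜ cs) N))) (erase (inst cs M))
    ≈⟨ β-β {a = c} {r = erase (inst (c ∷ᶜ cs) N)} ⟩
      subst c (erase (inst cs M)) (erase (inst (c ∷ᶜ cs) N))
    ≡⟨ sym (erase-substR c (inst cs M) (inst (c ∷ᶜ cs) N)) ⟩
      erase (substR c (inst cs M) (inst (c ∷ᶜ cs) N))
    ≡⟨ cong erase (inst-[] cs c N M c#N cs≢c) ⟩
      erase (inst cs (N [ M ])) ∎
    where
      open SetoidReasoning =β-setoid
      c = fresh (atoms N ++ tabulate cs)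
      c#N = fresh-# N (atoms N ++ tabulate cs) ∈-++⁺ˡ
      cs≢c = fresh-avoids (atoms N) cs
  erase-step (ξ {φ = φ} {N} {N'} s) cs = begin
      erase (inst cs (lm φ N))
    ≡⟨ erase-inst-lm cs c φ N c#N cs≢c ⟩
      ƛ c φ (erase (inst (c ∷ᶜ cs) N))
    ≈⟨ β-lam (erase-step s (c ∷ᶜ cs)) ⟩
      ƛ c φ (erase (inst (c ∷ᶜ cs) N'))
    ≡⟨ sym (erase-inst-lm cs c φ N' c#N' cs≢c) ⟩
      erase (inst cs (lm φ N')) ∎
    where
      open SetoidReasoning =β-setoid
      A = atoms N ++ atoms N'
      c = fresh (A ++ tabulate cs)
      c#N = fresh-# N (A ++ tabulate cs) (λ b∈ → ∈-++⁺ˡ (∈-++⁺ˡ b∈))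
      c#N' = fresh-# N' (A ++ tabulate cs) (λ b∈ → ∈-++⁺ˡ (∈-++⁺ʳ (atoms N) b∈))
      cs≢c = fresh-avoids A cs
  erase-step (appˡ s) cs = β-app (erase-step s cs) β-refl
  erase-step (appʳ s) cs = β-app β-refl (erase-step s cs)

  erase-≈β : {x y : Raw 0} → x ≈β y → erase x =β erase y
  erase-≈β = gfold =β-isEquivalence erase closed-step
    where closed-step : {x y : Raw 0} → x ⟶ y → erase x =β erase y
          closed-step {x} {y} s =
            Eq.subst₂ (λ u v → erase u =β erase v) (inst-closed x) (inst-closed y) (erase-step s noAtoms)

  Good : Env → Raw n → Set
  Good Γ = AllFree (λ b τ → (b , τ) ∈ Γ)

  Den : Env → Type → Raw 0 → Set
  Den Γ _ x = ∃ λ y → x ≈β y × Good Γ y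

  den-resp : ∀ {Γ φ x y} → x ≈β y → Den Γ φ x → Den Γ φ y
  den-resp x≈y (z , x≈z , good) = z , ≈β.trans (≈β.sym x≈y) x≈z , good

  den-abs : ∀ {Γ a φ ψ x} → Den ((a , φ) ∷ Γ) ψ x → Den Γ (φ ⇒ ψ) (absR a φ x)
  den-abs {Γ} {a} {φ} (y , x≈y , good) =
    absR a φ y , ≈β-lm (sub-≈β noSub (bindAt a) x≈y) , alm (AllFree-sub (λ ()) bound-or-in-Γ good)
    where
      in-Γ : ∀ {b τ} → (b , τ) ∈ ((a , φ) ∷ Γ) → a ≢ b → (b , τ) ∈ Γ
      in-Γ (here ba) a≢b = ⊥-elim (a≢b (sym (cong proj₁ ba)))
      in-Γ (there m) _   = m
      bound-or-in-Γ : ∀ b τ → (b , τ) ∈ ((a , φ) ∷ Γ) → Good Γ (bindAt a b τ)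
      bound-or-in-Γ b τ m = if-≟ (Good Γ) a b (λ _ → abv) (λ a≢b → afv (in-Γ m a≢b))

  den-app : ∀ {Γ φ ψ χ x y} → Den Γ φ x → Den Γ ψ y → Den Γ χ (ap x y)
  den-app (x' , x≈x' , gx) (y' , y≈y' , gy) = ap x' y' , ≈β-ap x≈x' y≈y' , aap gx gy

  -- The intersection property rests on Church–Rosser: Γ-good and Γ'-good
  -- representatives have a common reduct, which is good for both.
  den-inter : ∀ {Γ Γ' Δ} → IsIntersection Δ Γ Γ' →
              ∀ φ x → Den Δ φ x ⇔ (Den Γ φ x × Den Γ' φ x)
  den-inter {Γ} {Γ'} {Δ} iso φ x = mk⇔ to-both from-both
    where
      to-both : Den Δ φ x → Den Γ φ x × Den Γ' φ x
      to-both (y , x≈y , good) =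
        (y , x≈y , AllFree-map (λ b τ m → proj₁ (Equivalence.to (iso b τ) m)) good) ,
        (y , x≈y , AllFree-map (λ b τ m → proj₂ (Equivalence.to (iso b τ) m)) good)
      from-both : Den Γ φ x × Den Γ' φ x → Den Δ φ x
      from-both ((y₁ , x≈y₁ , good₁) , (y₂ , x≈y₂ , good₂))
        with church-rosser (≈β.trans (≈β.sym x≈y₁) x≈y₂)
      ... | w , y₁⇛*w , y₂⇛*w =
        w , ≈β.trans x≈y₁ (pars-≈β y₁⇛*w) ,
        AllFree-map (λ b τ both → Equivalence.from (iso b τ) both)
                    (AllFree-zip (AllFree-pars y₁⇛*w good₁) (AllFree-pars y₂⇛*w good₂))

  den-supported : ∀ {Γ φ x} → Den Γ φ x → Supports _≈β_ permR (dom Γ) x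
  den-supported {Γ} (y , x≈y , good) π fixes =
    ≈β.trans (sub-≈β bv (renameAt (to π)) x≈y)
             (≈β.trans (≈β.reflexive fixes-y) (≈β.sym x≈y))
    where fixes-y : permR π y ≡ y
          fixes-y = sub-id-on (λ _ → refl)
                              (λ b τ m → cong (λ b' → fv b' τ) (fixes b (∈-map⁺ proj₁ m))) good

  den-permute : ∀ π {Γ φ x} → Den Γ φ x → Den (permEnv π Γ) φ (permR π x)
  den-permute π (y , x≈y , good) =
    permR π y , sub-≈β bv (renameAt (to π)) x≈y ,
    AllFree-sub (λ ()) (λ b τ m → afv (∈-map⁺ (λ p → to π (proj₁ p) , proj₂ p) m)) good

  den-unpermute : ∀ π {Γ φ y} → Den (permEnv π Γ) φ y → ∃ λ x → Den Γ φ x × y ≈β permR π x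
  den-unpermute π {Γ} {y = y} (w , y≈w , good) =
    unpermute y , (unpermute w , sub-≈β bv (renameAt (from π)) y≈w , good-unpermuted) ,
    ≈β.reflexive (sym permute-unpermute)
    where
      unpermute : Raw 0 → Raw 0
      unpermute = sub bv (renameAt (from π))
      permute-unpermute : permR π (unpermute y) ≡ y
      permute-unpermute =
        trans (sub-sub bv (renameAt (to π)) bv (renameAt (from π)) y)
              (sub-id (λ _ → refl) (λ a τ → cong (λ b → fv b τ) (Perm.to-from π a)) y)
      unpermuted : ∀ b τ → (b , τ) ∈ permEnv π Γ → Good Γ (renameAt (from π) b τ)
      unpermuted b τ m with ∈-map⁻ (λ p → to π (proj₁ p) , proj₂ p) m
      ... | (c , τ') , c∈Γ , refl =
        afv (Eq.subst (λ e → (e , τ') ∈ Γ) (sym (Perm.from-to π c)) c∈Γ)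
      good-unpermuted : Good Γ (unpermute w)
      good-unpermuted = AllFree-sub (λ ()) unpermuted good

  -- The substitution axioms hold by β-conversion; for the two with a
  -- freshness side condition, the nominal freshness is first made
  -- syntactic with a convertible representative.
  β-var : ∀ a φ x → ap (absR a φ (fv a φ)) x ≈β x
  β-var a φ x = ≈β.trans (β-named a φ (fv a φ) x) (≈β.reflexive (if-≟-same a))

  β-fresh : ∀ a φ x z A → a ∉ A → Supports _≈β_ permR A z → ap (absR a φ z) x ≈β z
  β-fresh a φ x z A a∉A supported with fresh-representative a A z a∉A supported
  ... | z' , z≈z' , a#z' = begin
      ap (absR a φ z) x  ≈⟨ β-named a φ z x ⟩
      substR a x z       ≈⟨ sub-≈β bv (substAt a x) z≈z' ⟩
      substR a x z'      ≡⟨ substR-# a x z' a#z' ⟩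
      z'                 ≈⟨ ≈β.sym z≈z' ⟩
      z                  ∎
    where open SetoidReasoning (≈β-setoid 0)

  β-distrib : ∀ a φ x z' z →
              ap (absR a φ (ap z' z)) x ≈β ap (ap (absR a φ z') x) (ap (absR a φ z) x)
  β-distrib a φ x z' z =
    ≈β.trans (β-named a φ (ap z' z) x) (≈β.sym (≈β-ap (β-named a φ z' x) (β-named a φ z x)))

  -- Substitution passes under a binder c: with x replaced by a convertible
  -- representative avoiding c, this is the syntactic fact substR-bind.
  β-under-abs : ∀ a φ x c χ z → a ≢ c → ∀ A → c ∉ A → Supports _≈β_ permR A x →
                ap (absR a φ (absR c χ z)) x ≈β absR c χ (ap (absR a φ z) x)
  β-under-abs a φ x c χ z a≢c A c∉A supported with fresh-representative c A x c∉A supported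
  ... | x' , x≈x' , c#x' = ≈β.trans (β-named a φ (absR c χ z) x) (≈β-lm (begin
      sub (liftSub bv) (liftFree (substAt a x)) (bind c z)
    ≈⟨ sub-≈β-free (liftSub bv) (λ b τ → ren-≈β suc (substAt-≈β a x≈x' b τ)) (bind c z) ⟩
      sub (liftSub bv) (liftFree (substAt a x')) (bind c z)
    ≡⟨ substR-bind a c x' z a≢c c#x' ⟩
      bind c (substR a x' z)
    ≈⟨ sub-≈β noSub (bindAt c) (sub-≈β-free bv (λ b τ → ≈β.sym (substAt-≈β a x≈x' b τ)) z) ⟩
      bind c (substR a x z)
    ≈⟨ sub-≈β noSub (bindAt c) (≈β.sym (β-named a φ z x)) ⟩
      bind c (ap (absR a φ z) x) ∎))
    where open SetoidReasoning (≈β-setoid 1)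

  termModel : Model
  termModel = record
    { Carrier   = Raw 0
    ; _≈_       = _≈β_
    ; ≈-equiv   = ≈β-isEquivalence
    ; act       = permR
    ; act-cong  = λ π → sub-≈β bv (renameAt (to π))
    ; act-id    = λ π x fixed → ≈β.reflexive (permR-id π x fixed)
    ; act-comp  = λ π σ τ x comp → ≈β.reflexive (permR-comp π σ τ x comp)
    ; I         = Den
    ; I-resp    = λ Γ φ → den-resp {Γ} {φ}
    ; var       = fv
    ; cst       = cn
    ; abs       = absR
    ; _•_       = ap
    ; abs-cong  = λ a φ x≈y → ≈β-lm (sub-≈β noSub (bindAt a) x≈y)
    ; •-cong    = ≈β-ap
    ; var∈      = λ Γ _ a φ m → fv a φ , ≈β.refl , afv m
    ; cst∈      = λ Γ _ C → cn C , ≈β.refl , acn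
    ; abs∈      = λ Γ _ a φ ψ x _ → den-abs {Γ} {a} {φ} {ψ}
    ; •∈        = λ Γ _ φ ψ x y → den-app {Γ} {φ ⇒ ψ} {φ} {ψ}
    ; I-inter   = λ Γ Γ' Δ _ _ _ → den-inter
    ; I-supp    = λ Γ _ φ x → den-supported {Γ} {φ}
    ; I-equiv₁  = λ π Γ _ φ x → den-permute π {Γ} {φ}
    ; I-equiv₂  = λ π Γ _ φ y → den-unpermute π {Γ} {φ}
    ; var-equiv = λ π a φ → ≈β.refl
    ; cst-equiv = λ π C → ≈β.refl
    ; abs-equiv = λ π a φ x → ≈β.reflexive (permR-absR π a φ x)
    ; •-equiv   = λ π x y → ≈β.refl
    ; sub-var   = λ Γ _ a φ x _ _ → β-var a φ x
    ; sub-#     = λ { Γ _ a φ x _ _ ψ z _ (A , a∉A , supported) → β-fresh a φ x z A a∉A supported }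
    ; sub-•     = λ Γ _ a φ x _ _ χ ψ z' z _ _ → β-distrib a φ x z' z
    ; sub-abs   = λ { Γ _ a φ x _ _ c χ ψ z c∉ (A , c∉A , supported) _ →
                      β-under-abs a φ x c χ z (λ a≡c → c∉ (here (sym a≡c))) A c∉A supported }
    }

  erase-interp : ∀ {Γ r φ} (d : Γ ⊢ r ∶ φ) → erase (⟦ termModel ⟧ d) ≡ r
  erase-interp (⊢var _)           = refl
  erase-interp ⊢con               = refl
  erase-interp (⊢lam {a} {φ} _ d) =
    cong (lam φ) (trans (erase-bind a (⟦ termModel ⟧ d)) (cong (close a) (erase-interp d)))
  erase-interp (⊢app d e)         = cong₂ app (erase-interp d) (erase-interp e)

  completeness : (Γ : Env) (r s : Term) → ((M : Model) → ValidIn M Γ r s) → r =β s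
  completeness Γ r s valid with valid termModel
  ... | φ , dr , ds , dr≈ds = Eq.subst₂ _=β_ (erase-interp dr) (erase-interp ds) (erase-≈β dr≈ds)

theorem3p11 : (B : Set) → B → (K : Set) → (type : K → Ty B) →
    let open Lambda B K type in
    (Γ : Env) → Functional Γ → (r s : Term) →
    ((M : Model) → ValidIn M Γ r s) →
    r =β s
theorem3p11 B b₀ K type Γ _ = Completeness.completeness B b₀ K type Γ
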